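{- Let $\Sigma$ be a finite set and let $\Omega$ be the map defined on the set $\mathcal P$ of all prefix-free subsets of $\Sigma^+$ by $$\Omega(P)(n)=\begin{cases}\Downarrow & \text{if } n\in P,\\ n^{ -1}\cdot P & \text{otherwise},\end{cases}\qquad P\in\mathcal P,\ n\in\Sigma.$$ Then $\Omega$ is a $\Sigma$-detector with carrier $\mathcal P$, and it is a final object of the category of $\Sigma$-detectors: for every $\Sigma$-detector $a:A\to(\mathbf 1+A)^{\Sigma}$ there is exactly one detector morphism from $a$ to $\Omega$, and it is the map $a^{\dagger}:A\to\mathcal P$, $$a^{\dagger}(x)=\{u\in\Sigma^+ \mid a^+(x,u)=\Downarrow \text{ and } a^+(x,u[0:k])\neq\Downarrow \text{ whenever } 0<k<|u|\}.$$
   Context: $\Sigma^*$ denotes the set of finite words over $\Sigma$ (including the empty word $\varepsilon$), $\Sigma^+$ the set of nonempty words, $|u|$ the length of $u$, $uv$ concatenation, and a letter $n\in\Sigma$ is identified with the word of length one. For a word $u$ and $0\le k\le |u|$, $u[0:k]$ is the prefix of $u$ of length $k$. A set $P\subseteq\Sigma^*$ is prefix-free if $u\in P$ implies $u[0:m]\notin P$ for all $0\le m<|u|$. For $P\subseteq\Sigma^*$ and $n\in\Sigma$, $n^{ -1}\cdot P=\{u\in\Sigma^*\mid nu\in P\}$. $\mathbf 1=\{\Downarrow\}$ is a one-element set (a fault indicator) and $+$ is disjoint union. A $\Sigma$-detector is a map $a:A\to(\mathbf 1+A)^{\Sigma}$, $A$ its carrier (state set); we write $a(x)(n)$ for the value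 of $a(x)$ at $n$. A detector morphism from $a:A\to(\mathbf 1+A)^\Sigma$ to $b:B\to(\mathbf 1+B)^\Sigma$ is a map $f:A\to B$ such that for all $x\in A$, $n\in\Sigma$: $a(x)(n)=\Downarrow$ iff $b(f(x))(n)=\Downarrow$, and if $a(x)(n)\neq\Downarrow$ then $b(f(x))(n)=f(a(x)(n))$. For a detector $a$ with carrier $A$, the map $a^+:A\times\Sigma^+\to\mathbf 1+A$ is defined by $a^+(x,n)=a(x)(n)$ and $a^+(x,un)=\Downarrow$ if $a^+(x,u)=\Downarrow$, and $a^+(x,un)=a(a^+(x,u))(n)$ otherwise ($x\in A$, $n\in\Sigma$, $u\in\Sigma^+$). -}

module Defs where

open import Data.Bool using (Bool; true; false)
open import Data.Nat using (ℕ; suc; _<_; s≤s)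
open import Data.List using (List; []; _∷_; length; take; foldl)
open import Data.Maybe using (Maybe; just; nothing)
open import Data.Product using (Σ; ∃; _×_; _,_)
open import Relation.Binary.PropositionalEquality using (_≡_; refl)
open import Relation.Nullary using (¬_)
open import Function.Bundles using (_⇔_)

-- 1 + A is rendered as  Maybe A , with  nothing  playing the fault indicator ⇓.

module _ (Σ' : Set) where

  Detector : Set → Set
  Detector A = A → Σ' → Maybe A

  record PF : Set where
    field
      mem        : List Σ' → Bool
      nonempty   : mem [] ≡ false
      prefixFree : ∀ (u : List Σ') (m : ℕ) → m < length u → mem u ≡ true → mem (take m u) ≡ false
  open PF public

  _≈PF_ : PF → PF → Set
  P ≈PF Q = ∀ u → mem P u ≡ mem Q u

  derivPF : (P : PF) (n : Σ') → mem P (n ∷ []) ≡ false → PF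
  derivPF P n nP = record
    { mem = λ u → mem P (n ∷ u)
    ; nonempty = nP
    ; prefixFree = λ u m m<u uP → prefixFree P (n ∷ u) (suc m) (s≤s m<u) uP
    }

  Ω-aux : (P : PF) (n : Σ') (b : Bool) → mem P (n ∷ []) ≡ b → Maybe PF
  Ω-aux P n true  _  = nothing
  Ω-aux P n false eq = just (derivPF P n eq)

  Ω : Detector PF
  Ω P n = Ω-aux P n (mem P (n ∷ [])) refl

  -- detector morphisms from (A, a) to (B, b), where equality on the target carrier
  -- is given by a relation _≈_ (≡ for ordinary sets, ≈PF for 𝒫)
  IsMorphism : {A B : Set} (_≈_ : B → B → Set) → Detector A → Detector B → (A → B) → Set
  IsMorphism {A} {B} _≈_ a b f =
    ∀ (x : A) (n : Σ') →
      ((a x n ≡ nothing) ⇔ (b (f x) n ≡ nothing))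
      × (∀ (y : A) → a x n ≡ just y → Σ B λ z → (b (f x) n ≡ just z) × (z ≈ f y))

  -- a⁺(x, n v) for the nonempty word n v, defined by the paper's recursion on
  -- the last letter: a⁺(x,n) = a(x)(n), a⁺(x,u m) = ⇓ if a⁺(x,u)=⇓, else a(a⁺(x,u))(m)
  step : {A : Set} → Detector A → Maybe A → Σ' → Maybe A
  step a nothing  m = nothing
  step a (just y) m = a y m

  a⁺ : {A : Set} → Detector A → A → Σ' → List Σ' → Maybe A
  a⁺ a x n v = foldl (step a) (a x n) v

  -- u ∈ a†(x):  u = n v ∈ Σ⁺, a⁺(x,u) = ⇓, and a⁺(x, u[0:k]) ≠ ⇓ for 0 < k < |u|
  -- (the prefix u[0:k] with k = j+1 is n (v[0:j]), 0 ≤ j < |v|)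
  InDagger : {A : Set} → Detector A → A → List Σ' → Set
  InDagger a x u =
    Σ Σ' λ n → Σ (List Σ') λ v →
      (u ≡ n ∷ v) × (a⁺ a x n v ≡ nothing)
      × (∀ (j : ℕ) → j < length v → ¬ (a⁺ a x n (take j v) ≡ nothing))

module Submission where

-- Membership in a†(x) is computed by a Boolean recursion that runs the
-- detector letter by letter: the empty word is never accepted, and  n v  is
-- accepted from  x  iff reading  n  faults and  v = ε, or reading  n  leads to
-- a state  y  from which  v  is accepted.
-- The theorem is the combination of 1–3.

open import Defs
open import Data.Nat using (ℕ; zero; suc; _<_; s≤s; z≤n)
open import Data.Fin using (Fin)
open import Data.Bool using (Bool; true; false)
open import Data.Bool.Properties using (¬-not)
open import Data.List using (List; []; _∷_; length; take; foldl)
open import Data.Maybe using (Maybe; just; nothing)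
open import Data.Maybe.Properties using (just-injective)
open import Data.Product using (Σ; _×_; _,_; proj₁; proj₂)
open import Relation.Binary.PropositionalEquality
  using (_≡_; _≢_; refl; sym; trans; cong)
open import Relation.Nullary using (¬_)
open import Data.Empty using (⊥-elim)
open import Function.Bundles using (_↔_; _⇔_; mk⇔; Equivalence)
open import Function.Properties.Equivalence using () renaming (trans to ⇔-trans)

module OmegaTransitions (S : Set) where

  -- Ω-aux is Ω with the membership test of [n] generalised, so we can split on it.
  Ω-aux-fault : ∀ P n b (e : mem P (n ∷ []) ≡ b) →
                Ω-aux S P n b e ≡ nothing ⇔ b ≡ true
  Ω-aux-fault P n true  e = mk⇔ (λ _ → refl) (λ _ → refl)
  Ω-aux-fault P n false e = mk⇔ (λ ()) (λ ())

  Ω-fault : ∀ P n → Ω S P n ≡ nothing ⇔ mem P (n ∷ []) ≡ true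
  Ω-fault P n = Ω-aux-fault P n _ refl

  Ω-aux-step : ∀ P n b (e : mem P (n ∷ []) ≡ b) (Q : PF S) →
               Ω-aux S P n b e ≡ just Q → ∀ u → mem Q u ≡ mem P (n ∷ u)
  Ω-aux-step P n false e Q eq u = cong (λ R → mem R u) (sym (just-injective eq))

  Ω-step : ∀ P n (Q : PF S) → Ω S P n ≡ just Q → ∀ u → mem Q u ≡ mem P (n ∷ u)
  Ω-step P n = Ω-aux-step P n _ refl

  Ω-aux-defined : ∀ P n b (e : mem P (n ∷ []) ≡ b) → b ≡ false →
                  Σ (PF S) λ Q → Ω-aux S P n b e ≡ just Q
  Ω-aux-defined P n false e _ = derivPF S P n e , refl

  Ω-defined : ∀ P n → mem P (n ∷ []) ≡ false → Σ (PF S) λ Q → Ω S P n ≡ just Q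
  Ω-defined P n = Ω-aux-defined P n _ refl

module Finality (S : Set) {A : Set} (a : Detector S A) where

  open OmegaTransitions S

  MembershipEquations : (A → PF S) → Set
  MembershipEquations g =
    ∀ x n → ((a x n ≡ nothing) ⇔ (mem (g x) (n ∷ []) ≡ true))
          × (∀ y → a x n ≡ just y → ∀ u → mem (g x) (n ∷ u) ≡ mem (g y) u)

  morphism⇒equations : ∀ g → IsMorphism S (_≈PF_ S) a (Ω S) g → MembershipEquations g
  morphism⇒equations g mor x n = faults , steps
    where
    faults : (a x n ≡ nothing) ⇔ (mem (g x) (n ∷ []) ≡ true)
    faults = mk⇔ (λ e → Equivalence.to (Ω-fault (g x) n) (Equivalence.to (proj₁ (mor x n)) e))
                 (λ m → Equivalence.from (proj₁ (mor x n)) (Equivalence.from (Ω-fault (g x) n) m))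
    steps : ∀ y → a x n ≡ just y → ∀ u → mem (g x) (n ∷ u) ≡ mem (g y) u
    steps y e u with proj₂ (mor x n) y e
    ... | Q , ΩQ , Q≈gy = trans (sym (Ω-step (g x) n Q ΩQ u)) (Q≈gy u)

  equations⇒morphism : ∀ g → MembershipEquations g → IsMorphism S (_≈PF_ S) a (Ω S) g
  equations⇒morphism g eqs x n = faults , steps
    where
    faults : (a x n ≡ nothing) ⇔ (Ω S (g x) n ≡ nothing)
    faults = mk⇔ (λ e → Equivalence.from (Ω-fault (g x) n) (Equivalence.to (proj₁ (eqs x n)) e))
                 (λ e → Equivalence.from (proj₁ (eqs x n)) (Equivalence.to (Ω-fault (g x) n) e))
    -- [n] ∉ g x since it corresponds to the empty word of g y
    steps : ∀ y → a x n ≡ just y → Σ (PF S) λ Q → (Ω S (g x) n ≡ just Q) × (_≈PF_ S Q (g y))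
    steps y e with Ω-defined (g x) n (trans (proj₂ (eqs x n) y e []) (nonempty (g y)))
    ... | Q , ΩQ = Q , ΩQ , λ u → trans (Ω-step (g x) n Q ΩQ u) (proj₂ (eqs x n) y e u)

  -- accepts x u: u ∈ a†(x), computed letter by letter;
  -- acceptsAfter r v: v completes a word to its first fault, r being the
  -- outcome of reading the first letter.
  accepts      : A → List S → Bool
  acceptsAfter : Maybe A → List S → Bool
  accepts x []      = false
  accepts x (n ∷ v) = acceptsAfter (a x n) v
  acceptsAfter nothing  []      = true
  acceptsAfter nothing  (_ ∷ _) = false
  acceptsAfter (just y) v       = accepts y v

  accepts-prefixFree : ∀ x u m → m < length u → accepts x u ≡ true →
                       accepts x (take m u) ≡ false
  after-prefixFree   : ∀ r v m → m < length v → acceptsAfter r v ≡ true →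
                       acceptsAfter r (take m v) ≡ false
  accepts-prefixFree x (n ∷ v) zero    _         _ = refl
  accepts-prefixFree x (n ∷ v) (suc m) (s≤s m<v) h = after-prefixFree (a x n) v m m<v h
  after-prefixFree nothing  (_ ∷ _) m _   ()
  after-prefixFree (just y) v       m m<v h = accepts-prefixFree y v m m<v h

  dagger : A → PF S
  dagger x = record
    { mem = accepts x ; nonempty = refl ; prefixFree = accepts-prefixFree x }

  run : Maybe A → List S → Maybe A
  run = foldl (step S a)

  FirstFault : Maybe A → List S → Set
  FirstFault r v = (run r v ≡ nothing) × (∀ j → j < length v → run r (take j v) ≢ nothing)

  -- From a state y, the first letter never faults prematurely (j = 0 is y itself).
  firstFault-cons : ∀ y m v → FirstFault (a y m) v ⇔ FirstFault (just y) (m ∷ v)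
  firstFault-cons y m v = mk⇔
    (λ (hit , clear) → hit , λ { zero _ () ; (suc j) (s≤s j<v) → clear j j<v })
    (λ (hit , clear) → hit , λ j j<v → clear (suc j) (s≤s j<v))

  acceptsAfter⇔firstFault : ∀ r v → acceptsAfter r v ≡ true ⇔ FirstFault r v
  acceptsAfter⇔firstFault nothing  []      = mk⇔ (λ _ → refl , λ _ ()) (λ _ → refl)
  acceptsAfter⇔firstFault (just y) []      = mk⇔ (λ ()) (λ { (() , _) })
  acceptsAfter⇔firstFault nothing  (m ∷ v) =
    mk⇔ (λ ()) (λ (_ , clear) → ⊥-elim (clear zero (s≤s z≤n) refl))
  acceptsAfter⇔firstFault (just y) (m ∷ v) =
    ⇔-trans (acceptsAfter⇔firstFault (a y m) v) (firstFault-cons y m v)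

  accepts⇔dagger : ∀ x u → accepts x u ≡ true ⇔ InDagger S a x u
  accepts⇔dagger x []      = mk⇔ (λ ()) (λ { (_ , _ , () , _) })
  accepts⇔dagger x (n ∷ v) = mk⇔
    (λ h → let (hit , clear) = Equivalence.to (acceptsAfter⇔firstFault (a x n) v) h
           in n , v , refl , hit , clear)
    (λ { (.n , .v , refl , hit , clear) →
           Equivalence.from (acceptsAfter⇔firstFault (a x n) v) (hit , clear) })

  dagger-equations : MembershipEquations dagger
  dagger-equations x n = faults (a x n) , λ y e u → cong (λ r → acceptsAfter r u) e
    where
    faults : ∀ r → (r ≡ nothing) ⇔ (acceptsAfter r [] ≡ true)
    faults nothing  = mk⇔ (λ _ → refl) (λ _ → refl)
    faults (just y) = mk⇔ (λ ()) (λ ())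

  -- Any solution of the membership equations is dagger: at a fault on n, the
  -- word n itself is accepted, so no proper extension of it can be.
  equations⇒dagger : ∀ g → MembershipEquations g → ∀ x u → mem (g x) u ≡ accepts x u
  equations⇒dagger g eqs x []      = nonempty (g x)
  equations⇒dagger g eqs x (n ∷ v) with a x n in e
  ... | just y = trans (proj₂ (eqs x n) y e v) (equations⇒dagger g eqs y v)
  ... | nothing with v
  ...   | []    = Equivalence.to (proj₁ (eqs x n)) e
  ...   | m ∷ w = ¬-not λ nmw∈gx →
          true≢false (trans (sym (Equivalence.to (proj₁ (eqs x n)) e))
                            (prefixFree (g x) (n ∷ m ∷ w) 1 (s≤s (s≤s z≤n)) nmw∈gx))
    where
    true≢false : ¬ (true ≡ false)
    true≢false ()

theorem1 : (k : ℕ) (S : Set) → Fin k ↔ S →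
    (A : Set) (a : Detector S A) →
    Σ (A → PF S) (λ f →
    IsMorphism S (_≈PF_ S) a (Ω S) f
    × (∀ (x : A) (u : List S) → (mem (f x) u ≡ true) ⇔ InDagger S a x u))
    × (∀ (g : A → PF S) → IsMorphism S (_≈PF_ S) a (Ω S) g →
    ∀ (x : A) (u : List S) → (mem (g x) u ≡ true) ⇔ InDagger S a x u)
theorem1 k S _ A a =
  (dagger , equations⇒morphism dagger dagger-equations , accepts⇔dagger) ,
  λ g mor x u →
    let g≡dagger = equations⇒dagger g (morphism⇒equations g mor) x u
    in mk⇔ (λ h → Equivalence.to (accepts⇔dagger x u) (trans (sym g≡dagger) h))
           (λ h → trans g≡dagger (Equivalence.from (accepts⇔dagger x u) h))
  where open Finality S a
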